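{- Let \(\kappa\) be a cube-consistent diamond field on \(J(P)\) and let \(\alpha:J(P)\setminus\{\varnothing\}\to\mathbb R\) be any function. Then there exists a unique edge field \(g\) such that (1) \(g(K^-,m(K))=\alpha(K)\) for every nonempty ideal \(K\), and (2) the curvature field of \(g\) equals \(\kappa\).
   Context: Let \(P=(S,\preceq)\) be a finite poset, and fix a total order \(\tau\) on \(S\) extending \(\preceq\); write \(u<_\tau v\) if \(u\) precedes \(v\) in \(\tau\). \(J(P)\) is the set of downward-closed subsets (ideals) of \(S\). For \(I\in J(P)\), \(\mathcal A(I)=\{a\in S\setminus I:\ \{u:u\prec a\}\subseteq I\}\). An edge field is a function \(g:\{(I,a):I\in J(P),a\in\mathcal A(I)\}\to\mathbb R\). A diamond \((K;a,b)\) consists of \(K\in J(P)\) and incomparable \(a,b\in\mathcal A(K)\) with \(a<_\tau b\); the curvature field of \(g\) is \(\kappa_g(K;a,b)=g(K,b)+g(K\cup\{b\},a)-g(K,a)-g(K\cup\{a\},b)\). A diamond field is any real function on the set of diamonds; it is cube-consistent if for every \(I\in J(P)\) and pairwise incomparable \(u<_\tau v<_\tau w\) in \(\mathcal A(I)\): \(\kappa(I;u,v)-\kappa(I\cup\{w\};u,v)-\kappa(I;u,w)+\kappa(I\cup\{v\};u,w)+\kappa(I;v,w)-\kappa(I\cup\{u\};v,w)=0\). For a nonempty ideal \(K\), \(m(K)\) is the \(<_\tau\)-maximum element of \(K\) and \(K^-=K\setminus\{m(K)\}\). -}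

module Defs where

open import Data.Nat using (ℕ)
open import Data.Fin using (Fin)
open import Data.Fin.Subset using (Subset; _∈_; _∉_; _∪_; ⁅_⁆) renaming (_-_ to _∖_)
open import Data.Product using (_×_; Σ)
open import Relation.Binary.PropositionalEquality using (_≡_; _≢_)
open import Relation.Binary.Structures using (IsPartialOrder; IsStrictTotalOrder)
open import Relation.Nullary using (¬_)
open import Algebra.Bundles using (AbelianGroup)
open import Level using (Level)

record FinPosetτ (n : ℕ) : Set₁ where
  field
    _≼_ : Fin n → Fin n → Set
    isPartialOrder : IsPartialOrder _≡_ _≼_
    _<τ_ : Fin n → Fin n → Set
    isStrictTotalOrder : IsStrictTotalOrder _≡_ _<τ_
    extends : ∀ {u v} → u ≼ v → u ≢ v → u <τ v

  _≺_ : Fin n → Fin n → Set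
  u ≺ v = (u ≼ v) × (u ≢ v)

  Incomparable : Fin n → Fin n → Set
  Incomparable a b = (¬ (a ≼ b)) × (¬ (b ≼ a))

  IsIdeal : Subset n → Set
  IsIdeal I = ∀ u v → u ≼ v → v ∈ I → u ∈ I

  Addable : Subset n → Fin n → Set
  Addable I a = (a ∉ I) × (∀ u → u ≺ a → u ∈ I)

  IsDiamond : Subset n → Fin n → Fin n → Set
  IsDiamond K a b =
    IsIdeal K × Addable K a × Addable K b × Incomparable a b × (a <τ b)

  IsTauMax : Subset n → Fin n → Set
  IsTauMax K k = (k ∈ K) × (∀ u → u ∈ K → u ≢ k → u <τ k)

  NonEmpty : Subset n → Set
  NonEmpty K = Σ (Fin n) (λ u → u ∈ K)

module _ {n : ℕ} (P : FinPosetτ n) {c ℓ : Level} (G : AbelianGroup c ℓ) where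
  open FinPosetτ P
  open AbelianGroup G

  -- Edge fields, diamond fields and α are represented as total functions;
  -- only their values on the relevant domain matter.
  EdgeField : Set c
  EdgeField = Subset n → Fin n → Carrier

  DiamondField : Set c
  DiamondField = Subset n → Fin n → Fin n → Carrier

  curvature : EdgeField → DiamondField
  curvature g K a b = ((g K b ∙ g (K ∪ ⁅ b ⁆) a) - g K a) - g (K ∪ ⁅ a ⁆) b

  CubeConsistent : DiamondField → Set ℓ
  CubeConsistent κ =
    ∀ I u v w → IsIdeal I → Addable I u → Addable I v → Addable I w →
    Incomparable u v → Incomparable u w → Incomparable v w →
    u <τ v → v <τ w →
    (((((κ I u v - κ (I ∪ ⁅ w ⁆) u v) - κ I u w) ∙ κ (I ∪ ⁅ v ⁆) u w)
       ∙ κ I v w) - κ (I ∪ ⁅ u ⁆) v w) ≈ ε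

  MatchesAlpha : (Subset n → Carrier) → EdgeField → Set ℓ
  MatchesAlpha α g = ∀ K k → IsIdeal K → IsTauMax K k → g (K ∖ k) k ≈ α K

  HasCurvature : DiamondField → EdgeField → Set ℓ
  HasCurvature κ g = ∀ K a b → IsDiamond K a b → curvature g K a b ≈ κ K a b

  EdgeEq : EdgeField → EdgeField → Set ℓ
  EdgeEq g g' = ∀ I a → IsIdeal I → Addable I a → g I a ≈ g' I a

-- If a lies τ-above I, then (I, a) is the top edge (K⁻, m(K)) of K = I ∪ {a} and (1)
-- fixes g there. Otherwise a <τ m = m(I), and (I, a) is an edge of the diamond (I ∖ m; a, m) whose
-- other edges are two top edges and the edge (I ∖ m, a) of a smaller ideal; so (2) determines g by
-- recursion on |I|. This proves uniqueness and defines g. The curvature of this g is κ on a diamond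
-- (K; a, b): by construction if b lies τ-above K, and otherwise by induction on |K|, since (K; a, b)
-- is a face of the cube (K⁻; a, b, m(K)) whose other five faces already carry curvature κ, while
-- both κ and the curvature of any edge field satisfy the cube identity (for the latter, each edge
-- of the cube lies on exactly two faces, with opposite signs).

module Submission where

open import Algebra.Bundles using (AbelianGroup)
open import Data.Fin using (Fin; zero; suc; _≟_)
open import Data.Fin.Subset using (Subset; _∈_; _∉_; _∪_; ⁅_⁆; ∣_∣; inside; outside) renaming (_-_ to _∖_)
open import Data.Fin.Subset.Properties
  using (x∈p∪q⁻; x∈p∪q⁺; x∈⁅x⁆; x∈⁅y⁆⇒x≡y; x∈p∧x≢y⇒x∈p-y; p─q⊆p; p─⊥≡p; ⊆-antisym; ∪-assoc; ∪-comm;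
         _∈?_; x∈p⇒∣p-x∣<∣p∣)
open import Data.List using ([]; _∷_; allFin)
open import Data.List.Membership.Propositional.Properties using (∈-allFin)
open import Data.List.Relation.Unary.All as All using (All; []; _∷_)
open import Data.Nat using (ℕ; zero; suc; _<_)
open import Data.Nat.Induction using (<-wellFounded)
open import Data.Product using (Σ; _×_; _,_; proj₁; proj₂)
open import Data.Sum using (_⊎_; inj₁; inj₂; [_,_]; map₂)
open import Data.Vec using (_∷_; here; there)
open import Function using (id; _∘_)
open import Induction.WellFounded as WF using (WellFounded; WfRec)
open import Level using (Level; _⊔_; 0ℓ)
open import Relation.Binary.Construct.On as On using ()
open import Relation.Binary.Core using (Rel)
open import Relation.Binary.Definitions using (tri<; tri≈; tri>)
open import Relation.Binary.PropositionalEquality as ≡ using (_≡_; _≢_; refl; module ≡-Reasoning)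
open import Relation.Binary.Structures using (IsStrictTotalOrder)
open import Relation.Nullary using (¬_; yes; no; contradiction)
open import Relation.Unary using (Pred; Decidable)

open import Defs

private variable
  n : ℕ

x∈p∪⁅y⁆⁻ : ∀ {p : Subset n} {x y} → x ∈ p ∪ ⁅ y ⁆ → x ∈ p ⊎ x ≡ y
x∈p∪⁅y⁆⁻ {p = p} {y = y} x∈ = map₂ (x∈⁅y⁆⇒x≡y y) (x∈p∪q⁻ p ⁅ y ⁆ x∈)

x∈p⇒x∈p∪⁅y⁆ : ∀ {p : Subset n} {x y} → x ∈ p → x ∈ p ∪ ⁅ y ⁆
x∈p⇒x∈p∪⁅y⁆ x∈p = x∈p∪q⁺ (inj₁ x∈p)

y∈p∪⁅y⁆ : ∀ {p : Subset n} {y} → y ∈ p ∪ ⁅ y ⁆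
y∈p∪⁅y⁆ {y = y} = x∈p∪q⁺ (inj₂ (x∈⁅x⁆ y))

x∉p-x : ∀ {p : Subset n} x → x ∉ p ∖ x
x∉p-x {p = _ ∷ _} zero    ()
x∉p-x {p = _ ∷ _} (suc x) (there x∈p-x) = x∉p-x x x∈p-x

x∈p-y⁻ : ∀ {p : Subset n} {x y} → x ∈ p ∖ y → x ∈ p × x ≢ y
x∈p-y⁻ {p = p} {x} {y} x∈ = p─q⊆p p ⁅ y ⁆ x∈ , λ { refl → x∉p-x x x∈ }

p∪⁅x⁆-x≡p : ∀ {p : Subset n} {x} → x ∉ p → (p ∪ ⁅ x ⁆) ∖ x ≡ p
p∪⁅x⁆-x≡p {p = p} {x} x∉p = ⊆-antisym ⊆p p⊆
  where
  ⊆p : ∀ {y} → y ∈ (p ∪ ⁅ x ⁆) ∖ x → y ∈ p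
  ⊆p y∈ with x∈p-y⁻ y∈
  ... | y∈p∪x , y≢x = [ id , (λ y≡x → contradiction y≡x y≢x) ] (x∈p∪⁅y⁆⁻ y∈p∪x)
  p⊆ : ∀ {y} → y ∈ p → y ∈ (p ∪ ⁅ x ⁆) ∖ x
  p⊆ y∈p = x∈p∧x≢y⇒x∈p-y (x∈p⇒x∈p∪⁅y⁆ y∈p) λ { refl → x∉p y∈p }

p-x∪⁅x⁆≡p : ∀ {p : Subset n} {x} → x ∈ p → (p ∖ x) ∪ ⁅ x ⁆ ≡ p
p-x∪⁅x⁆≡p {p = p} {x} x∈p = ⊆-antisym ⊆p p⊆
  where
  ⊆p : ∀ {y} → y ∈ (p ∖ x) ∪ ⁅ x ⁆ → y ∈ p
  ⊆p y∈ = [ proj₁ ∘ x∈p-y⁻ , (λ { refl → x∈p }) ] (x∈p∪⁅y⁆⁻ y∈)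
  p⊆ : ∀ {y} → y ∈ p → y ∈ (p ∖ x) ∪ ⁅ x ⁆
  p⊆ {y} y∈p with y ≟ x
  ... | yes refl = y∈p∪⁅y⁆
  ... | no y≢x  = x∈p⇒x∈p∪⁅y⁆ (x∈p∧x≢y⇒x∈p-y y∈p y≢x)

p∪⁅x⁆∪⁅y⁆≡p∪⁅y⁆∪⁅x⁆ : ∀ (p : Subset n) x y → (p ∪ ⁅ x ⁆) ∪ ⁅ y ⁆ ≡ (p ∪ ⁅ y ⁆) ∪ ⁅ x ⁆
p∪⁅x⁆∪⁅y⁆≡p∪⁅y⁆∪⁅x⁆ p x y = begin
  (p ∪ ⁅ x ⁆) ∪ ⁅ y ⁆  ≡⟨ ∪-assoc p ⁅ x ⁆ ⁅ y ⁆ ⟩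
  p ∪ (⁅ x ⁆ ∪ ⁅ y ⁆)  ≡⟨ ≡.cong (p ∪_) (∪-comm ⁅ x ⁆ ⁅ y ⁆) ⟩
  p ∪ (⁅ y ⁆ ∪ ⁅ x ⁆)  ≡⟨ ≡.sym (∪-assoc p ⁅ y ⁆ ⁅ x ⁆) ⟩
  (p ∪ ⁅ y ⁆) ∪ ⁅ x ⁆  ∎
  where open ≡-Reasoning

∣p∣≡1+∣p-x∣ : ∀ {p : Subset n} {x} → x ∈ p → ∣ p ∣ ≡ suc ∣ p ∖ x ∣
∣p∣≡1+∣p-x∣ {p = inside  ∷ p} here        = ≡.cong (λ q → suc ∣ q ∣) (≡.sym (p─⊥≡p p))
∣p∣≡1+∣p-x∣ {p = inside  ∷ p} (there x∈p) = ≡.cong suc (∣p∣≡1+∣p-x∣ x∈p)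
∣p∣≡1+∣p-x∣ {p = outside ∷ p} (there x∈p) = ∣p∣≡1+∣p-x∣ x∈p

_⊏_ : Rel (Subset n) 0ℓ
p ⊏ q = ∣ p ∣ < ∣ q ∣

⊏-wellFounded : WellFounded (_⊏_ {n})
⊏-wellFounded = On.wellFounded ∣_∣ <-wellFounded

module _ {a ℓ p} {A : Set a} {_<_ : Rel A ℓ} (<-sto : IsStrictTotalOrder _≡_ _<_)
         {P : Pred A p} (P? : Decidable P) where
  open IsStrictTotalOrder <-sto using (compare) renaming (trans to <-trans)

  Dominates : A → A → Set (a ⊔ ℓ ⊔ p)
  Dominates m x = P x → x ≢ m → x < m

  greatest? : ∀ xs → Σ A (λ m → P m × All (Dominates m) xs) ⊎ All (¬_ ∘ P) xs
  greatest? [] = inj₂ []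
  greatest? (x ∷ xs) with P? x | greatest? xs
  ... | no ¬px | inj₂ none           = inj₂ (¬px ∷ none)
  ... | no ¬px | inj₁ (m , pm , dom) = inj₁ (m , pm , (λ px _ → contradiction px ¬px) ∷ dom)
  ... | yes px | inj₂ none           =
    inj₁ (x , px , (λ _ x≢x → contradiction refl x≢x) ∷ All.map (λ ¬pu pu → contradiction pu ¬pu) none)
  ... | yes px | inj₁ (m , pm , dom) with compare x m
  ...   | tri< x<m _ _  = inj₁ (m , pm , (λ _ _ → x<m) ∷ dom)
  ...   | tri≈ _ refl _ = inj₁ (m , pm , (λ _ m≢m → contradiction refl m≢m) ∷ dom)
  ...   | tri> _ _ m<x  = inj₁ (x , px , (λ _ x≢x → contradiction refl x≢x) ∷ All.map raise dom)
    where
    raise : ∀ {u} → Dominates m u → Dominates x u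
    raise {u} u≤m pu _ with compare u m
    ... | tri< u<m _ _  = <-trans u<m m<x
    ... | tri≈ _ refl _ = m<x
    ... | tri> _ u≢m _  = <-trans (u≤m pu u≢m) m<x

module AbelianGroupLemmas {c ℓ} (G : AbelianGroup c ℓ) where
  open AbelianGroup G renaming (refl to ≈-refl)
  open import Algebra.Properties.AbelianGroup G
  open import Algebra.Properties.CommutativeSemigroup commutativeSemigroup using (interchange)
  open import Algebra.Solver.CommutativeMonoid commutativeMonoid using (solve; _⊜_; _⊕_)
  open import Relation.Binary.Reasoning.Setoid setoid

  cubeSum : Carrier → Carrier → Carrier → Carrier → Carrier → Carrier → Carrier
  cubeSum c₁ c₂ c₃ c₄ c₅ c₆ = ((((c₁ - c₂) - c₃) ∙ c₄) ∙ c₅) - c₆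

  cubeSum-cong : ∀ {c₁ c₂ c₃ c₄ c₅ c₆ d₁ d₂ d₃ d₄ d₅ d₆} →
    c₁ ≈ d₁ → c₂ ≈ d₂ → c₃ ≈ d₃ → c₄ ≈ d₄ → c₅ ≈ d₅ → c₆ ≈ d₆ →
    cubeSum c₁ c₂ c₃ c₄ c₅ c₆ ≈ cubeSum d₁ d₂ d₃ d₄ d₅ d₆
  cubeSum-cong e₁ e₂ e₃ e₄ e₅ e₆ =
    //-cong₂ (∙-cong (∙-cong (//-cong₂ (//-cong₂ e₁ e₂) e₃) e₄) e₅) e₆

  cubeSum-injective₂ : ∀ {c₁ c₂ d₂ c₃ c₄ c₅ c₆} →
    cubeSum c₁ c₂ c₃ c₄ c₅ c₆ ≈ cubeSum c₁ d₂ c₃ c₄ c₅ c₆ → c₂ ≈ d₂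
  cubeSum-injective₂ {c₁} {c₃ = c₃} {c₄} {c₅} {c₆} eq =
    ⁻¹-injective (∙-cancelˡ c₁ _ _ (∙-cancelʳ (c₃ ⁻¹) _ _
      (∙-cancelʳ c₄ _ _ (∙-cancelʳ c₅ _ _ (∙-cancelʳ (c₆ ⁻¹) _ _ eq)))))

  cubeSum-determines₂ : ∀ {c₁ c₂ c₃ c₄ c₅ c₆ d₁ d₂ d₃ d₄ d₅ d₆} →
    cubeSum c₁ c₂ c₃ c₄ c₅ c₆ ≈ ε → cubeSum d₁ d₂ d₃ d₄ d₅ d₆ ≈ ε →
    c₁ ≈ d₁ → c₃ ≈ d₃ → c₄ ≈ d₄ → c₅ ≈ d₅ → c₆ ≈ d₆ → c₂ ≈ d₂
  cubeSum-determines₂ c≈ε d≈ε e₁ e₃ e₄ e₅ e₆ = cubeSum-injective₂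
    (trans c≈ε (sym (trans (cubeSum-cong e₁ ≈-refl e₃ e₄ e₅ e₆) d≈ε)))

  [x-y]∙[u-v]≈[x∙u]-[y∙v] : ∀ x y u v → (x - y) ∙ (u - v) ≈ (x ∙ u) - (y ∙ v)
  [x-y]∙[u-v]≈[x∙u]-[y∙v] x y u v =
    trans (interchange x (y ⁻¹) u (v ⁻¹)) (∙-congˡ (⁻¹-∙-comm y v))

  [x-y]-[u-v]≈[x∙v]-[y∙u] : ∀ x y u v → (x - y) - (u - v) ≈ (x ∙ v) - (y ∙ u)
  [x-y]-[u-v]≈[x∙v]-[y∙u] x y u v =
    trans (∙-congˡ (⁻¹-anti-homo‿- u v)) ([x-y]∙[u-v]≈[x∙u]-[y∙v] x y v u)

  x-y-z≈x-[y∙z] : ∀ x y z → (x - y) - z ≈ x - (y ∙ z)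
  x-y-z≈x-[y∙z] x y z = trans (assoc x (y ⁻¹) (z ⁻¹)) (∙-congˡ (⁻¹-∙-comm y z))

  cubeSum-of-differences : ∀ x₁ y₁ x₂ y₂ x₃ y₃ x₄ y₄ x₅ y₅ x₆ y₆ →
    cubeSum (x₁ - y₁) (x₂ - y₂) (x₃ - y₃) (x₄ - y₄) (x₅ - y₅) (x₆ - y₆) ≈
    (x₁ ∙ y₂ ∙ y₃ ∙ x₄ ∙ x₅ ∙ y₆) - (y₁ ∙ x₂ ∙ x₃ ∙ y₄ ∙ y₅ ∙ x₆)
  cubeSum-of-differences x₁ y₁ x₂ y₂ x₃ y₃ x₄ y₄ x₅ y₅ x₆ y₆ = begin
    cubeSum (x₁ - y₁) (x₂ - y₂) (x₃ - y₃) (x₄ - y₄) (x₅ - y₅) (x₆ - y₆)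
      ≈⟨ ∙-congʳ (∙-congʳ (∙-congʳ (∙-congʳ ([x-y]-[u-v]≈[x∙v]-[y∙u] x₁ y₁ x₂ y₂)))) ⟩
    ((((x₁ ∙ y₂ - y₁ ∙ x₂) - (x₃ - y₃)) ∙ (x₄ - y₄)) ∙ (x₅ - y₅)) - (x₆ - y₆)
      ≈⟨ ∙-congʳ (∙-congʳ (∙-congʳ ([x-y]-[u-v]≈[x∙v]-[y∙u] _ _ x₃ y₃))) ⟩
    (((x₁ ∙ y₂ ∙ y₃ - y₁ ∙ x₂ ∙ x₃) ∙ (x₄ - y₄)) ∙ (x₅ - y₅)) - (x₆ - y₆)
      ≈⟨ ∙-congʳ (∙-congʳ ([x-y]∙[u-v]≈[x∙u]-[y∙v] _ _ x₄ y₄)) ⟩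
    ((x₁ ∙ y₂ ∙ y₃ ∙ x₄ - y₁ ∙ x₂ ∙ x₃ ∙ y₄) ∙ (x₅ - y₅)) - (x₆ - y₆)
      ≈⟨ ∙-congʳ ([x-y]∙[u-v]≈[x∙u]-[y∙v] _ _ x₅ y₅) ⟩
    (x₁ ∙ y₂ ∙ y₃ ∙ x₄ ∙ x₅ - y₁ ∙ x₂ ∙ x₃ ∙ y₄ ∙ y₅) - (x₆ - y₆)
      ≈⟨ [x-y]-[u-v]≈[x∙v]-[y∙u] _ _ x₆ y₆ ⟩
    (x₁ ∙ y₂ ∙ y₃ ∙ x₄ ∙ x₅ ∙ y₆) - (y₁ ∙ x₂ ∙ x₃ ∙ y₄ ∙ y₅ ∙ x₆) ∎

  -- eˣy is the value on the edge from the vertex x of the cube to x ∪ {y}; 0 is its bottom vertex.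
  cubeSum-of-curvatures : ∀ e⁰u e⁰v e⁰w eᵘv eᵘw eᵛu eᵛw eʷu eʷv eᵛʷu eᵘʷv eᵘᵛw →
    cubeSum (((e⁰v ∙ eᵛu) - e⁰u) - eᵘv) (((eʷv ∙ eᵛʷu) - eʷu) - eᵘʷv)
            (((e⁰w ∙ eʷu) - e⁰u) - eᵘw) (((eᵛw ∙ eᵛʷu) - eᵛu) - eᵘᵛw)
            (((e⁰w ∙ eʷv) - e⁰v) - eᵛw) (((eᵘw ∙ eᵘʷv) - eᵘv) - eᵘᵛw) ≈ ε
  cubeSum-of-curvatures e⁰u e⁰v e⁰w eᵘv eᵘw eᵛu eᵛw eʷu eʷv eᵛʷu eᵘʷv eᵘᵛw = begin
    cubeSum (((e⁰v ∙ eᵛu) - e⁰u) - eᵘv) (((eʷv ∙ eᵛʷu) - eʷu) - eᵘʷv)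
            (((e⁰w ∙ eʷu) - e⁰u) - eᵘw) (((eᵛw ∙ eᵛʷu) - eᵛu) - eᵘᵛw)
            (((e⁰w ∙ eʷv) - e⁰v) - eᵛw) (((eᵘw ∙ eᵘʷv) - eᵘv) - eᵘᵛw)
      ≈⟨ cubeSum-cong (x-y-z≈x-[y∙z] _ _ _) (x-y-z≈x-[y∙z] _ _ _) (x-y-z≈x-[y∙z] _ _ _)
                      (x-y-z≈x-[y∙z] _ _ _) (x-y-z≈x-[y∙z] _ _ _) (x-y-z≈x-[y∙z] _ _ _) ⟩
    cubeSum ((e⁰v ∙ eᵛu) - (e⁰u ∙ eᵘv)) ((eʷv ∙ eᵛʷu) - (eʷu ∙ eᵘʷv))
            ((e⁰w ∙ eʷu) - (e⁰u ∙ eᵘw)) ((eᵛw ∙ eᵛʷu) - (eᵛu ∙ eᵘᵛw))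
            ((e⁰w ∙ eʷv) - (e⁰v ∙ eᵛw)) ((eᵘw ∙ eᵘʷv) - (eᵘv ∙ eᵘᵛw))
      ≈⟨ cubeSum-of-differences _ _ _ _ _ _ _ _ _ _ _ _ ⟩
    (e⁰v ∙ eᵛu ∙ (eʷu ∙ eᵘʷv) ∙ (e⁰u ∙ eᵘw) ∙ (eᵛw ∙ eᵛʷu) ∙ (e⁰w ∙ eʷv) ∙ (eᵘv ∙ eᵘᵛw)) -
    (e⁰u ∙ eᵘv ∙ (eʷv ∙ eᵛʷu) ∙ (e⁰w ∙ eʷu) ∙ (eᵛu ∙ eᵘᵛw) ∙ (e⁰v ∙ eᵛw) ∙ (eᵘw ∙ eᵘʷv))
      ≈⟨ x≈y⇒x∙y⁻¹≈ε (each-edge-twice e⁰u e⁰v e⁰w eᵘv eᵘw eᵛu eᵛw eʷu eʷv eᵛʷu eᵘʷv eᵘᵛw) ⟩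
    ε ∎
    where
    each-edge-twice : ∀ e⁰u e⁰v e⁰w eᵘv eᵘw eᵛu eᵛw eʷu eʷv eᵛʷu eᵘʷv eᵘᵛw →
      e⁰v ∙ eᵛu ∙ (eʷu ∙ eᵘʷv) ∙ (e⁰u ∙ eᵘw) ∙ (eᵛw ∙ eᵛʷu) ∙ (e⁰w ∙ eʷv) ∙ (eᵘv ∙ eᵘᵛw) ≈
      e⁰u ∙ eᵘv ∙ (eʷv ∙ eᵛʷu) ∙ (e⁰w ∙ eʷu) ∙ (eᵛu ∙ eᵘᵛw) ∙ (e⁰v ∙ eᵛw) ∙ (eᵘw ∙ eᵘʷv)
    each-edge-twice = solve 12 (λ e⁰u e⁰v e⁰w eᵘv eᵘw eᵛu eᵛw eʷu eʷv eᵛʷu eᵘʷv eᵘᵛw →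
      (((((e⁰v ⊕ eᵛu) ⊕ (eʷu ⊕ eᵘʷv)) ⊕ (e⁰u ⊕ eᵘw)) ⊕ (eᵛw ⊕ eᵛʷu)) ⊕ (e⁰w ⊕ eʷv)) ⊕ (eᵘv ⊕ eᵘᵛw)
      ⊜ (((((e⁰u ⊕ eᵘv) ⊕ (eʷv ⊕ eᵛʷu)) ⊕ (e⁰w ⊕ eʷu)) ⊕ (eᵛu ⊕ eᵘᵛw)) ⊕ (e⁰v ⊕ eᵛw)) ⊕ (eᵘw ⊕ eᵘʷv))
      ≈-refl

module Ideals {n} (P : FinPosetτ n) where
  open FinPosetτ P
  open IsStrictTotalOrder isStrictTotalOrder using (compare; asym; irrefl) renaming (trans to <τ-trans)

  IsTauUpperBound : Subset n → Fin n → Set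
  IsTauUpperBound I a = ∀ u → u ∈ I → u <τ a

  τ-max? : ∀ I → Σ (Fin n) (IsTauMax I) ⊎ (∀ u → u ∉ I)
  τ-max? I with greatest? isStrictTotalOrder (_∈? I) (allFin n)
  ... | inj₁ (m , m∈I , dom) = inj₁ (m , m∈I , λ u → All.lookup dom (∈-allFin u))
  ... | inj₂ none            = inj₂ λ u → All.lookup none (∈-allFin u)

  τ-max-unique : ∀ {I m m′} → IsTauMax I m → IsTauMax I m′ → m ≡ m′
  τ-max-unique {m = m} {m′} (m∈I , m-max) (m′∈I , m′-max) with m ≟ m′
  ... | yes m≡m′ = m≡m′
  ... | no m≢m′  = contradiction (m′-max m m∈I m≢m′) (asym (m-max m′ m′∈I (m≢m′ ∘ ≡.sym)))

  upperBound⇒∉ : ∀ {I a} → IsTauUpperBound I a → a ∉ I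
  upperBound⇒∉ bound a∈I = irrefl refl (bound _ a∈I)

  upperBound⇒τ-max-∪ : ∀ {I a} → IsTauUpperBound I a → IsTauMax (I ∪ ⁅ a ⁆) a
  upperBound⇒τ-max-∪ bound =
    y∈p∪⁅y⁆ , λ u u∈ u≢a → [ bound u , (λ u≡a → contradiction u≡a u≢a) ] (x∈p∪⁅y⁆⁻ u∈)

  upperBound-∪ : ∀ {I a b} → IsTauUpperBound I b → a <τ b → IsTauUpperBound (I ∪ ⁅ a ⁆) b
  upperBound-∪ bound a<b u u∈ = [ bound u , (λ { refl → a<b }) ] (x∈p∪⁅y⁆⁻ u∈)

  τ-max⇒upperBound-∖ : ∀ {I m} → IsTauMax I m → IsTauUpperBound (I ∖ m) m
  τ-max⇒upperBound-∖ (_ , m-max) u u∈ with x∈p-y⁻ u∈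
  ... | u∈I , u≢m = m-max u u∈I u≢m

  upperBound⊎below-τ-max : ∀ {I a} → a ∉ I →
    IsTauUpperBound I a ⊎ Σ (Fin n) (λ m → IsTauMax I m × a <τ m)
  upperBound⊎below-τ-max {I} {a} a∉I with τ-max? I
  ... | inj₂ empty = inj₁ (λ u u∈I → contradiction u∈I (empty u))
  ... | inj₁ (m , m-max) with compare a m
  ...   | tri< a<m _ _  = inj₂ (m , m-max , a<m)
  ...   | tri≈ _ refl _ = contradiction (proj₁ m-max) a∉I
  ...   | tri> _ _ m<a  = inj₁ below-a
    where
    below-a : IsTauUpperBound I a
    below-a u u∈I with u ≟ m
    ... | yes refl = m<a
    ... | no u≢m   = <τ-trans (proj₂ m-max u u∈I u≢m) m<a

  ideal-∪-addable : ∀ {I a} → IsIdeal I → Addable I a → IsIdeal (I ∪ ⁅ a ⁆)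
  ideal-∪-addable I-ideal (_ , below⊆I) u v u≼v v∈ with x∈p∪⁅y⁆⁻ v∈
  ... | inj₁ v∈I = x∈p⇒x∈p∪⁅y⁆ (I-ideal u v u≼v v∈I)
  ... | inj₂ refl with u ≟ v
  ...   | yes refl = y∈p∪⁅y⁆
  ...   | no u≢v   = x∈p⇒x∈p∪⁅y⁆ (below⊆I u (u≼v , u≢v))

  ideal-∖-τ-max : ∀ {K m} → IsIdeal K → IsTauMax K m → IsIdeal (K ∖ m)
  ideal-∖-τ-max K-ideal (_ , m-max) u v u≼v v∈ with x∈p-y⁻ v∈
  ... | v∈K , v≢m = x∈p∧x≢y⇒x∈p-y (K-ideal u v u≼v v∈K)
        λ { refl → asym (extends u≼v (v≢m ∘ ≡.sym)) (m-max v v∈K v≢m) }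

  τ-max-addable-∖ : ∀ {K m} → IsIdeal K → IsTauMax K m → Addable (K ∖ m) m
  τ-max-addable-∖ K-ideal (m∈K , _) =
    x∉p-x _ , λ u (u≼m , u≢m) → x∈p∧x≢y⇒x∈p-y (K-ideal u _ u≼m m∈K) u≢m

  addable-∖ : ∀ {K a m} → Addable K a → a <τ m → Addable (K ∖ m) a
  addable-∖ (a∉K , below⊆K) a<m =
    a∉K ∘ proj₁ ∘ x∈p-y⁻ ,
    λ u u≺a → x∈p∧x≢y⇒x∈p-y (below⊆K u u≺a) λ { refl → asym a<m (extends (proj₁ u≺a) (proj₂ u≺a)) }

  addable-incomparable : ∀ {K a m} → IsIdeal K → Addable K a → m ∈ K → a <τ m → Incomparable a m
  addable-incomparable K-ideal (a∉K , _) m∈K a<m =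
    (λ a≼m → a∉K (K-ideal _ _ a≼m m∈K)) ,
    (λ m≼a → asym a<m (extends m≼a λ { refl → a∉K m∈K }))

module Curvature {n} (P : FinPosetτ n) {c ℓ} (G : AbelianGroup c ℓ) where
  open AbelianGroup G
  open import Algebra.Properties.AbelianGroup G using (∙-cancelˡ; ∙-cancelʳ; //-cong₂)
  open AbelianGroupLemmas G

  CubeSum : DiamondField P G → Subset n → Fin n → Fin n → Fin n → Carrier
  CubeSum κ I u v w = cubeSum (κ I u v) (κ (I ∪ ⁅ w ⁆) u v) (κ I u w) (κ (I ∪ ⁅ v ⁆) u w)
                              (κ I v w) (κ (I ∪ ⁅ u ⁆) v w)

  curvature-cube : ∀ g I u v w → CubeSum (curvature P G g) I u v w ≈ ε
  curvature-cube g I u v w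
    rewrite p∪⁅x⁆∪⁅y⁆≡p∪⁅y⁆∪⁅x⁆ I w v | p∪⁅x⁆∪⁅y⁆≡p∪⁅y⁆∪⁅x⁆ I w u | p∪⁅x⁆∪⁅y⁆≡p∪⁅y⁆∪⁅x⁆ I v u
    = cubeSum-of-curvatures _ _ _ _ _ _ _ _ _ _ _ _

  curvature-injective : ∀ {g h K a b} → curvature P G g K a b ≈ curvature P G h K a b →
    g K b ≈ h K b → g K a ≈ h K a → g (K ∪ ⁅ a ⁆) b ≈ h (K ∪ ⁅ a ⁆) b →
    g (K ∪ ⁅ b ⁆) a ≈ h (K ∪ ⁅ b ⁆) a
  curvature-injective curv≈ e₁ e₂ e₃ = ∙-cancelˡ _ _ _ (∙-cancelʳ _ _ _ (∙-cancelʳ _ _ _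
    (trans curv≈ (//-cong₂ (//-cong₂ (∙-congʳ (sym e₁)) (sym e₂)) (sym e₃)))))

module Uniqueness {n} (P : FinPosetτ n) {c ℓ} (G : AbelianGroup c ℓ)
                  (κ : DiamondField P G) (α : Subset n → AbelianGroup.Carrier G) where
  open FinPosetτ P
  open AbelianGroup G
  open Ideals P
  open Curvature P G

  matchesAlpha-upperBound : ∀ {h I a} → MatchesAlpha P G α h → IsIdeal (I ∪ ⁅ a ⁆) →
    IsTauUpperBound I a → h I a ≈ α (I ∪ ⁅ a ⁆)
  matchesAlpha-upperBound {h} {I} {a} h-α I∪a-ideal bound =
    ≡.subst (λ J → h J a ≈ α (I ∪ ⁅ a ⁆)) (p∪⁅x⁆-x≡p (upperBound⇒∉ bound))
      (h-α (I ∪ ⁅ a ⁆) a I∪a-ideal (upperBound⇒τ-max-∪ bound))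

  unique : ∀ {h h′} → MatchesAlpha P G α h → HasCurvature P G κ h →
    MatchesAlpha P G α h′ → HasCurvature P G κ h′ → EdgeEq P G h h′
  unique {h} {h′} h-α h-κ h′-α h′-κ I = WF.All.wfRec ⊏-wellFounded ℓ Agree agree I
    where
    Agree : Subset n → Set ℓ
    Agree I = ∀ a → IsIdeal I → Addable I a → h I a ≈ h′ I a

    agree-upperBound : ∀ {I a} → IsIdeal (I ∪ ⁅ a ⁆) → IsTauUpperBound I a → h I a ≈ h′ I a
    agree-upperBound I∪a-ideal bound = trans (matchesAlpha-upperBound h-α I∪a-ideal bound)
                                             (sym (matchesAlpha-upperBound h′-α I∪a-ideal bound))

    agree : ∀ I → WfRec _⊏_ Agree I → Agree I
    agree I IH a I-ideal a∈𝒜 with upperBound⊎below-τ-max (proj₁ a∈𝒜)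
    ... | inj₁ bound = agree-upperBound (ideal-∪-addable I-ideal a∈𝒜) bound
    ... | inj₂ (m , m-max@(m∈I , _) , a<m) =
      ≡.subst (λ J → h J a ≈ h′ J a) (p-x∪⁅x⁆≡p m∈I)
        (curvature-injective {h} {h′} (trans (h-κ _ _ _ diamond) (sym (h′-κ _ _ _ diamond)))
          (agree-upperBound (≡.subst IsIdeal (≡.sym (p-x∪⁅x⁆≡p m∈I)) I-ideal) m-bound)
          (IH (x∈p⇒∣p-x∣<∣p∣ m∈I) a I⁻-ideal (addable-∖ a∈𝒜 a<m))
          (agree-upperBound I⁻∪a∪m-ideal (upperBound-∪ m-bound a<m)))
      where
      I⁻-ideal : IsIdeal (I ∖ m)
      I⁻-ideal = ideal-∖-τ-max I-ideal m-max
      m-bound : IsTauUpperBound (I ∖ m) m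
      m-bound = τ-max⇒upperBound-∖ m-max
      diamond : IsDiamond (I ∖ m) a m
      diamond = I⁻-ideal , addable-∖ a∈𝒜 a<m , τ-max-addable-∖ I-ideal m-max ,
                addable-incomparable I-ideal a∈𝒜 m∈I a<m , a<m
      I⁻∪a∪m-ideal : IsIdeal (((I ∖ m) ∪ ⁅ a ⁆) ∪ ⁅ m ⁆)
      I⁻∪a∪m-ideal = ≡.subst IsIdeal
        (≡.trans (≡.cong (_∪ ⁅ a ⁆) (≡.sym (p-x∪⁅x⁆≡p m∈I))) (p∪⁅x⁆∪⁅y⁆≡p∪⁅y⁆∪⁅x⁆ (I ∖ m) m a))
        (ideal-∪-addable I-ideal a∈𝒜)

module Construction {n} (P : FinPosetτ n) {c ℓ} (G : AbelianGroup c ℓ)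
                    (κ : DiamondField P G) (α : Subset n → AbelianGroup.Carrier G) where
  open FinPosetτ P
  open IsStrictTotalOrder isStrictTotalOrder using (compare; asym) renaming (trans to <τ-trans)
  open AbelianGroup G renaming (refl to ≈-refl)
  open import Algebra.Properties.AbelianGroup G using (//-cong₂; //-rightDividesˡ; //-rightDividesʳ)
  open import Relation.Binary.Reasoning.Setoid setoid
  open AbelianGroupLemmas G
  open Ideals P
  open Curvature P G

  -- The value at (I, a) below m = m(I) is forced by the curvature of the diamond (I ∖ m; a, m),
  -- whose two m-edges are top edges carrying α I and α (I ∪ {a}). Only k = ∣ I ∣ is meaningful.
  edgeOfSize : ℕ → EdgeField P G
  edgeOfSize zero    I a = α (I ∪ ⁅ a ⁆)
  edgeOfSize (suc k) I a with τ-max? I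
  ... | inj₂ _       = α (I ∪ ⁅ a ⁆)
  ... | inj₁ (m , _) with compare a m
  ...   | tri< _ _ _ = ((κ (I ∖ m) a m ∙ α (I ∪ ⁅ a ⁆)) ∙ edgeOfSize k (I ∖ m) a) - α I
  ...   | _          = α (I ∪ ⁅ a ⁆)

  g : EdgeField P G
  g I a = edgeOfSize ∣ I ∣ I a

  g-upperBound : ∀ {I a} → IsTauUpperBound I a → g I a ≡ α (I ∪ ⁅ a ⁆)
  g-upperBound {I} {a} bound with ∣ I ∣
  ... | zero = refl
  ... | suc k with τ-max? I
  ...   | inj₂ _ = refl
  ...   | inj₁ (m , m∈I , _) with compare a m
  ...     | tri< a<m _ _ = contradiction (bound m m∈I) (asym a<m)
  ...     | tri≈ _ _ _   = refl
  ...     | tri> _ _ _   = refl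

  g-below-τ-max : ∀ {I a m} → IsTauMax I m → a <τ m →
    g I a ≡ ((κ (I ∖ m) a m ∙ α (I ∪ ⁅ a ⁆)) ∙ g (I ∖ m) a) - α I
  g-below-τ-max {I} {a} {m} m-max a<m rewrite ∣p∣≡1+∣p-x∣ (proj₁ m-max) with τ-max? I
  ... | inj₂ empty = contradiction (proj₁ m-max) (empty m)
  ... | inj₁ (m′ , m′-max) with τ-max-unique m′-max m-max
  ...   | refl with compare a m
  ...     | tri< _ _ _   = refl
  ...     | tri≈ a≮m _ _ = contradiction a<m a≮m
  ...     | tri> a≮m _ _ = contradiction a<m a≮m

  g-matchesAlpha : MatchesAlpha P G α g
  g-matchesAlpha K k _ k-max =
    reflexive (≡.trans (g-upperBound (τ-max⇒upperBound-∖ k-max)) (≡.cong α (p-x∪⁅x⁆≡p (proj₁ k-max))))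

  g-curvature-upperBound : ∀ {K a b} → IsTauUpperBound K b → a <τ b → curvature P G g K a b ≈ κ K a b
  g-curvature-upperBound {K} {a} {b} bound a<b = begin
    ((g K b ∙ g (K ∪ ⁅ b ⁆) a) - g K a) - g (K ∪ ⁅ a ⁆) b
      ≈⟨ //-cong₂ (//-cong₂ (∙-cong (reflexive (g-upperBound bound)) (reflexive edge)) ≈-refl)
                  (reflexive (g-upperBound (upperBound-∪ bound a<b))) ⟩
    ((z ∙ (((k ∙ w) ∙ x) - z)) - x) - w
      ≈⟨ ∙-congʳ (∙-congʳ (trans (comm z _) (//-rightDividesˡ z _))) ⟩
    (((k ∙ w) ∙ x) - x) - w
      ≈⟨ ∙-congʳ (//-rightDividesʳ x (k ∙ w)) ⟩
    (k ∙ w) - w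
      ≈⟨ //-rightDividesʳ w k ⟩
    k ∎
    where
    k x z w : Carrier
    k = κ K a b
    x = g K a
    z = α (K ∪ ⁅ b ⁆)
    w = α ((K ∪ ⁅ a ⁆) ∪ ⁅ b ⁆)
    edge : g (K ∪ ⁅ b ⁆) a ≡ ((k ∙ w) ∙ x) - z
    edge = ≡.trans (g-below-τ-max (upperBound⇒τ-max-∪ bound) a<b)
      (≡.cong₂ (λ L M → ((κ L a b ∙ α M) ∙ g L a) - z)
               (p∪⁅x⁆-x≡p (upperBound⇒∉ bound)) (p∪⁅x⁆∪⁅y⁆≡p∪⁅y⁆∪⁅x⁆ K b a))

  g-hasCurvature : CubeConsistent P G κ → HasCurvature P G κ g
  g-hasCurvature κ-cube K = WF.All.wfRec ⊏-wellFounded ℓ Flat flat K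
    where
    Flat : Subset n → Set ℓ
    Flat K = ∀ a b → IsDiamond K a b → curvature P G g K a b ≈ κ K a b

    flat : ∀ K → WfRec _⊏_ Flat K → Flat K
    flat K IH a b (K-ideal , a∈𝒜 , b∈𝒜 , a∥b , a<b) with upperBound⊎below-τ-max (proj₁ b∈𝒜)
    ... | inj₁ bound = g-curvature-upperBound bound a<b
    ... | inj₂ (m , m-max@(m∈K , _) , b<m) =
      ≡.subst (λ L → curvature P G g L a b ≈ κ L a b) (p-x∪⁅x⁆≡p m∈K)
        (cubeSum-determines₂ (curvature-cube g (K ∖ m) a b m)
          (κ-cube (K ∖ m) a b m K⁻-ideal a∈𝒜⁻ b∈𝒜⁻ (τ-max-addable-∖ K-ideal m-max) a∥b
                  (addable-incomparable K-ideal a∈𝒜 m∈K a<m) (addable-incomparable K-ideal b∈𝒜 m∈K b<m)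
                  a<b b<m)
          (IH (x∈p⇒∣p-x∣<∣p∣ m∈K) a b (K⁻-ideal , a∈𝒜⁻ , b∈𝒜⁻ , a∥b , a<b))
          (g-curvature-upperBound m-bound a<m)
          (g-curvature-upperBound (upperBound-∪ m-bound b<m) a<m)
          (g-curvature-upperBound m-bound b<m)
          (g-curvature-upperBound (upperBound-∪ m-bound a<m) b<m))
      where
      a<m : a <τ m
      a<m = <τ-trans a<b b<m
      K⁻-ideal : IsIdeal (K ∖ m)
      K⁻-ideal = ideal-∖-τ-max K-ideal m-max
      a∈𝒜⁻ : Addable (K ∖ m) a
      a∈𝒜⁻ = addable-∖ a∈𝒜 a<m
      b∈𝒜⁻ : Addable (K ∖ m) b
      b∈𝒜⁻ = addable-∖ b∈𝒜 b<m
      m-bound : IsTauUpperBound (K ∖ m) m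
      m-bound = τ-max⇒upperBound-∖ m-max

theorem4 : ∀ {n : ℕ} (P : FinPosetτ n) {c ℓ : Level} (G : AbelianGroup c ℓ)
    (κ : DiamondField P G) → CubeConsistent P G κ →
    (α : Subset n → AbelianGroup.Carrier G) →
    Σ (EdgeField P G) (λ g →
      (MatchesAlpha P G α g × HasCurvature P G κ g) ×
      (∀ g' → MatchesAlpha P G α g' → HasCurvature P G κ g' → EdgeEq P G g g'))
theorem4 P G κ κ-cube α =
  g , (g-matchesAlpha , g-hasCurvature κ-cube) ,
  λ h h-α h-κ → unique g-matchesAlpha (g-hasCurvature κ-cube) h-α h-κ
  where
  open Construction P G κ α
  open Uniqueness P G κ α
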